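{- Let $(F_n)_{n\ge1}$ be the Fibonacci numbers, $F_1=F_2=1$, $F_n=F_{n-1}+F_{n-2}$. Then for every integer $n\ge0$, $$F_{2n+2}=(-1)^n\sum_{k=0}^n\left(\binom{n+k+2}{n-k}-\binom{n+k+1}{n-k-1}\right)(-5)^k,$$ $$F_{2n+1}=(-1)^n\sum_{k=0}^n\left(\binom{n+k+2}{n-k}-\binom{n+k}{n-k-2}\right)(-5)^k.$$
   Context: Binomial coefficients $\binom{a}{b}$ with $b<0$ are taken to be $0$. -}

module Defs where

open import Data.Nat using (ℕ; zero; suc; _+_)
open import Data.Nat.Combinatorics using (_C_)
open import Data.Integer using (ℤ; +_; -[1+_]; _*_) renaming (_+_ to _+ℤ_)

fib : ℕ → ℕ
fib zero = zero
fib (suc zero) = suc zero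
fib (suc (suc n)) = fib (suc n) + fib n

binomℤ : ℕ → ℤ → ℤ
binomℤ a (+ b) = + (a C b)
binomℤ a -[1+ _ ] = + 0

_^ℤ_ : ℤ → ℕ → ℤ
x ^ℤ zero = + 1
x ^ℤ suc n = x * (x ^ℤ n)

sumTo : ℕ → (ℕ → ℤ) → ℤ
sumTo zero f = f zero
sumTo (suc n) f = sumTo n f +ℤ f (suc n)

module Submission where

-- Both identities are evaluations at x = -5 of the Morgan–Voyce polynomials
--   b_n(x) = Σ_k C(n+k, n-k) x^k,    B_n(x) = Σ_k C(n+k+1, n-k) x^k.

open import Defs
open import Data.Nat using (ℕ; zero; suc; _<_; z≤n; s≤s) renaming (_+_ to _+ℕ_; _*_ to _*ℕ_)
import Data.Nat.Properties as ℕP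
open import Data.Nat.Combinatorics using (_C_; nCn≡1; nCk≡nC[n∸k]; nCk+nC[k+1]≡[n+1]C[k+1])
open import Data.Integer using (ℤ; +_; -[1+_]; 0ℤ; 1ℤ; _⊖_; _+_; _-_; _*_)
import Data.Integer.Properties as ℤP
open import Data.Integer.Tactic.RingSolver using (solve-∀)
open import Data.Product using (_×_; _,_; proj₁; proj₂)
open import Relation.Binary.PropositionalEquality
open ≡-Reasoning

nC0≡1 : ∀ n → n C 0 ≡ 1
nC0≡1 n = trans (nCk≡nC[n∸k] {0} {n} z≤n) (nCn≡1 n)

-- Pascal's rule for binomial coefficients with integer lower index of the
-- form m - k; the convention binomℤ a b = 0 for b < 0 makes it hold for all m, k.
binomℤ-pascal : ∀ a m k → binomℤ (suc a) (m ⊖ k) ≡ binomℤ a (m ⊖ k) + binomℤ a (m ⊖ suc k)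
binomℤ-pascal a zero    zero    = cong +_ (trans (nC0≡1 (suc a)) (sym (nC0≡1 a)))
binomℤ-pascal a (suc m) zero    = begin
  + (suc a C suc m)            ≡⟨ cong +_ (nCk+nC[k+1]≡[n+1]C[k+1] a m) ⟨
  + (a C m +ℕ a C suc m)       ≡⟨ cong +_ (ℕP.+-comm (a C m) (a C suc m)) ⟩
  + (a C suc m +ℕ a C m)       ≡⟨ ℤP.pos-+ (a C suc m) (a C m) ⟩
  + (a C suc m) + + (a C m)    ∎
binomℤ-pascal a zero    (suc k) = refl
binomℤ-pascal a (suc m) (suc k)
  rewrite ℤP.[1+m]⊖[1+n]≡m⊖n m k | ℤP.[1+m]⊖[1+n]≡m⊖n m (suc k) = binomℤ-pascal a m k

binomℤ-vanish : ∀ a {m k} → m < k → binomℤ a (m ⊖ k) ≡ 0ℤ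
binomℤ-vanish a {zero}  {suc k} _       = refl
binomℤ-vanish a {suc m} {suc k} (s≤s p) rewrite ℤP.[1+m]⊖[1+n]≡m⊖n m k = binomℤ-vanish a p

sumTo-cong : ∀ n {f g : ℕ → ℤ} → (∀ k → f k ≡ g k) → sumTo n f ≡ sumTo n g
sumTo-cong zero    f≗g = f≗g zero
sumTo-cong (suc n) f≗g = cong₂ _+_ (sumTo-cong n f≗g) (f≗g (suc n))

sumTo-+ : ∀ n (f g : ℕ → ℤ) → sumTo n (λ k → f k + g k) ≡ sumTo n f + sumTo n g
sumTo-+ zero    f g = refl
sumTo-+ (suc n) f g = begin
  sumTo n (λ k → f k + g k) + (f (suc n) + g (suc n))
    ≡⟨ cong (_+ (f (suc n) + g (suc n))) (sumTo-+ n f g) ⟩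
  (sumTo n f + sumTo n g) + (f (suc n) + g (suc n))
    ≡⟨ interchange (sumTo n f) (sumTo n g) (f (suc n)) (g (suc n)) ⟩
  (sumTo n f + f (suc n)) + (sumTo n g + g (suc n)) ∎
  where
  interchange : ∀ a b c d → (a + b) + (c + d) ≡ (a + c) + (b + d)
  interchange = solve-∀

sumTo-*ˡ : ∀ n c (f : ℕ → ℤ) → sumTo n (λ k → c * f k) ≡ c * sumTo n f
sumTo-*ˡ zero    c f = refl
sumTo-*ˡ (suc n) c f = begin
  sumTo n (λ k → c * f k) + c * f (suc n) ≡⟨ cong (_+ c * f (suc n)) (sumTo-*ˡ n c f) ⟩
  c * sumTo n f + c * f (suc n)           ≡⟨ ℤP.*-distribˡ-+ c (sumTo n f) (f (suc n)) ⟨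
  c * (sumTo n f + f (suc n))             ∎

sumTo-head : ∀ n (f : ℕ → ℤ) → sumTo (suc n) f ≡ f 0 + sumTo n (λ k → f (suc k))
sumTo-head zero    f = refl
sumTo-head (suc n) f = begin
  sumTo (suc n) f + f (suc (suc n))
    ≡⟨ cong (_+ f (suc (suc n))) (sumTo-head n f) ⟩
  (f 0 + sumTo n (λ k → f (suc k))) + f (suc (suc n))
    ≡⟨ ℤP.+-assoc (f 0) _ _ ⟩
  f 0 + sumTo (suc n) (λ k → f (suc k)) ∎

sumTo-drop-last : ∀ n (f : ℕ → ℤ) → f (suc n) ≡ 0ℤ → sumTo (suc n) f ≡ sumTo n f
sumTo-drop-last n f fₙ₊₁≡0 = begin
  sumTo n f + f (suc n) ≡⟨ cong (λ t → sumTo n f + t) fₙ₊₁≡0 ⟩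
  sumTo n f + 0ℤ        ≡⟨ ℤP.+-identityʳ (sumTo n f) ⟩
  sumTo n f             ∎

bCoeff BCoeff : ℕ → ℕ → ℤ
bCoeff n k = binomℤ (n +ℕ k) (n ⊖ k)
BCoeff n k = binomℤ (suc (n +ℕ k)) (n ⊖ k)

morganVoyce-b morganVoyce-B : ℕ → ℤ → ℤ
morganVoyce-b n x = sumTo n (λ k → bCoeff n k * x ^ℤ k)
morganVoyce-B n x = sumTo n (λ k → BCoeff n k * x ^ℤ k)

BCoeff-rec : ∀ n k → BCoeff (suc n) k ≡ bCoeff (suc n) k + BCoeff n k
BCoeff-rec n k = begin
  binomℤ (suc (suc n +ℕ k)) (suc n ⊖ k)
    ≡⟨ binomℤ-pascal (suc n +ℕ k) (suc n) k ⟩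
  bCoeff (suc n) k + binomℤ (suc (n +ℕ k)) (suc n ⊖ suc k)
    ≡⟨ cong (λ z → bCoeff (suc n) k + binomℤ (suc (n +ℕ k)) z) (ℤP.[1+m]⊖[1+n]≡m⊖n n k) ⟩
  bCoeff (suc n) k + BCoeff n k ∎

bCoeff-rec : ∀ n k → bCoeff (suc n) (suc k) ≡ BCoeff n k + bCoeff n (suc k)
bCoeff-rec n k = begin
  binomℤ (suc (n +ℕ suc k)) (suc n ⊖ suc k)
    ≡⟨ cong (binomℤ (suc (n +ℕ suc k))) (ℤP.[1+m]⊖[1+n]≡m⊖n n k) ⟩
  binomℤ (suc (n +ℕ suc k)) (n ⊖ k)
    ≡⟨ binomℤ-pascal (n +ℕ suc k) n k ⟩
  binomℤ (n +ℕ suc k) (n ⊖ k) + bCoeff n (suc k)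
    ≡⟨ cong (λ a → binomℤ a (n ⊖ k) + bCoeff n (suc k)) (ℕP.+-suc n k) ⟩
  BCoeff n k + bCoeff n (suc k) ∎

bCoeff-const : ∀ n → bCoeff n 0 ≡ 1ℤ
bCoeff-const n = cong +_ (trans (cong (_C n) (ℕP.+-identityʳ n)) (nCn≡1 n))

bCoeff-top : ∀ n → bCoeff n (suc n) ≡ 0ℤ
bCoeff-top n = binomℤ-vanish (n +ℕ suc n) (ℕP.n<1+n n)

BCoeff-top : ∀ n → BCoeff n (suc n) ≡ 0ℤ
BCoeff-top n = binomℤ-vanish (suc (n +ℕ suc n)) (ℕP.n<1+n n)

morganVoyce-B-rec : ∀ n x → morganVoyce-B (suc n) x ≡ morganVoyce-b (suc n) x + morganVoyce-B n x
morganVoyce-B-rec n x = begin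
  sumTo (suc n) (λ k → BCoeff (suc n) k * x ^ℤ k)
    ≡⟨ sumTo-cong (suc n) (λ k → trans (cong (_* x ^ℤ k) (BCoeff-rec n k))
                                       (ℤP.*-distribʳ-+ (x ^ℤ k) (bCoeff (suc n) k) (BCoeff n k))) ⟩
  sumTo (suc n) (λ k → bCoeff (suc n) k * x ^ℤ k + BCoeff n k * x ^ℤ k)
    ≡⟨ sumTo-+ (suc n) _ _ ⟩
  morganVoyce-b (suc n) x + sumTo (suc n) (λ k → BCoeff n k * x ^ℤ k)
    ≡⟨ cong (_+_ (morganVoyce-b (suc n) x))
            (sumTo-drop-last n _ (cong (_* x ^ℤ suc n) (BCoeff-top n))) ⟩
  morganVoyce-b (suc n) x + morganVoyce-B n x ∎

morganVoyce-b-rec : ∀ n x → morganVoyce-b (suc n) x ≡ x * morganVoyce-B n x + morganVoyce-b n x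
morganVoyce-b-rec n x = begin
  morganVoyce-b (suc n) x
    ≡⟨ sumTo-head n _ ⟩
  bCoeff (suc n) 0 * 1ℤ + sumTo n (λ k → bCoeff (suc n) (suc k) * x ^ℤ suc k)
    ≡⟨ cong₂ _+_ (cong (_* 1ℤ) (trans (bCoeff-const (suc n)) (sym (bCoeff-const n))))
                 (sumTo-cong n shifted-term) ⟩
  bCoeff n 0 * 1ℤ + sumTo n (λ k → x * (BCoeff n k * x ^ℤ k) + bCoeff n (suc k) * x ^ℤ suc k)
    ≡⟨ cong (_+_ (bCoeff n 0 * 1ℤ)) (trans (sumTo-+ n _ _) (cong (_+ higher) (sumTo-*ˡ n x _))) ⟩
  bCoeff n 0 * 1ℤ + (x * morganVoyce-B n x + higher)
    ≡⟨ swap-front (bCoeff n 0 * 1ℤ) (x * morganVoyce-B n x) higher ⟩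
  x * morganVoyce-B n x + (bCoeff n 0 * 1ℤ + higher)
    ≡⟨ cong (_+_ (x * morganVoyce-B n x))
            (trans (sym (sumTo-head n _)) (sumTo-drop-last n _ (cong (_* x ^ℤ suc n) (bCoeff-top n)))) ⟩
  x * morganVoyce-B n x + morganVoyce-b n x ∎
  where
  higher : ℤ
  higher = sumTo n (λ k → bCoeff n (suc k) * x ^ℤ suc k)

  distrib : ∀ p q u v → (p + q) * (u * v) ≡ u * (p * v) + q * (u * v)
  distrib = solve-∀

  shifted-term : ∀ k → bCoeff (suc n) (suc k) * x ^ℤ suc k
                     ≡ x * (BCoeff n k * x ^ℤ k) + bCoeff n (suc k) * x ^ℤ suc k
  shifted-term k = trans (cong (_* x ^ℤ suc k) (bCoeff-rec n k)) (distrib (BCoeff n k) (bCoeff n (suc k)) x (x ^ℤ k))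

  swap-front : ∀ a c d → a + (c + d) ≡ c + (a + d)
  swap-front = solve-∀

sign : ℕ → ℤ
sign n = -[1+ 0 ] ^ℤ n

cancelʳ : ∀ a c → (a + c) - c ≡ a
cancelʳ = solve-∀

sign-distrib : ∀ s p q → (-[1+ 0 ] * s) * (p + q) ≡ (-[1+ 0 ] * s) * p - s * q
sign-distrib = solve-∀

F : ℕ → ℤ
F m = + fib m

fib-recℤ : ∀ m → F (2 +ℕ m) ≡ F (1 +ℕ m) + F m
fib-recℤ m = ℤP.pos-+ (fib (suc m)) (fib m)

fib-trisection : ∀ m → F (4 +ℕ m) ≡ + 3 * F (2 +ℕ m) - F m
fib-trisection m = begin
  F (4 +ℕ m)                        ≡⟨ fib-recℤ (2 +ℕ m) ⟩
  F (3 +ℕ m) + F (2 +ℕ m)           ≡⟨ cong₂ _+_ (trans (fib-recℤ (1 +ℕ m)) (cong (_+ a) (fib-recℤ m))) (fib-recℤ m) ⟩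
  ((a + c) + a) + (a + c)           ≡⟨ identity a c ⟩
  + 3 * (a + c) - c                 ≡⟨ cong (λ t → + 3 * t - c) (fib-recℤ m) ⟨
  + 3 * F (2 +ℕ m) - F m            ∎
  where
  a c : ℤ
  a = F (1 +ℕ m)
  c = F m

  identity : ∀ u v → ((u + v) + u) + (u + v) ≡ + 3 * (u + v) - v
  identity = solve-∀

fib-odd : ∀ j → F (1 +ℕ j) ≡ F (2 +ℕ j) - F j
fib-odd j = trans (sym (cancelʳ (F (1 +ℕ j)) (F j))) (cong (_- F j) (sym (fib-recℤ j)))

-- At x = -5 the Morgan–Voyce polynomials, up to the sign (-1)^n, are
-- B_n(-5) = F_{2n+2} and b_n(-5) = F_{2n+2} + F_{2n} (a Lucas number); both
-- follow together by induction from the recurrences and the trisection.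

morganVoyce-at-minus5 : ∀ n → sign n * morganVoyce-B n -[1+ 4 ] ≡ F (2 +ℕ 2 *ℕ n)
                            × sign n * morganVoyce-b n -[1+ 4 ] ≡ F (2 +ℕ 2 *ℕ n) + F (2 *ℕ n)
morganVoyce-at-minus5 zero    = refl , refl
morganVoyce-at-minus5 (suc n) = B-step , b-step
  where
  s Bₙ bₙ : ℤ
  s  = sign n
  Bₙ = morganVoyce-B n -[1+ 4 ]
  bₙ = morganVoyce-b n -[1+ 4 ]

  ih-B : s * Bₙ ≡ F (2 +ℕ 2 *ℕ n)
  ih-B = proj₁ (morganVoyce-at-minus5 n)

  ih-b : s * bₙ ≡ F (2 +ℕ 2 *ℕ n) + F (2 *ℕ n)
  ih-b = proj₂ (morganVoyce-at-minus5 n)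

  next : ∀ i → F (i +ℕ 2 *ℕ suc n) ≡ F (i +ℕ (2 +ℕ 2 *ℕ n))
  next i = cong (λ j → F (i +ℕ j)) (ℕP.*-suc 2 n)

  expand-b : ∀ s B b → (-[1+ 0 ] * s) * (-[1+ 4 ] * B + b) ≡ + 5 * (s * B) - s * b
  expand-b = solve-∀

  lucas-step : ∀ a c → + 5 * a - (a + c) ≡ (+ 3 * a - c) + a
  lucas-step = solve-∀

  b-step : sign (suc n) * morganVoyce-b (suc n) -[1+ 4 ] ≡ F (2 +ℕ 2 *ℕ suc n) + F (2 *ℕ suc n)
  b-step = begin
    (-[1+ 0 ] * s) * morganVoyce-b (suc n) -[1+ 4 ]
      ≡⟨ cong ((-[1+ 0 ] * s) *_) (morganVoyce-b-rec n -[1+ 4 ]) ⟩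
    (-[1+ 0 ] * s) * (-[1+ 4 ] * Bₙ + bₙ)
      ≡⟨ expand-b s Bₙ bₙ ⟩
    + 5 * (s * Bₙ) - s * bₙ
      ≡⟨ cong₂ (λ p q → + 5 * p - q) ih-B ih-b ⟩
    + 5 * F (2 +ℕ 2 *ℕ n) - (F (2 +ℕ 2 *ℕ n) + F (2 *ℕ n))
      ≡⟨ lucas-step (F (2 +ℕ 2 *ℕ n)) (F (2 *ℕ n)) ⟩
    (+ 3 * F (2 +ℕ 2 *ℕ n) - F (2 *ℕ n)) + F (2 +ℕ 2 *ℕ n)
      ≡⟨ cong₂ _+_ (trans (sym (fib-trisection (2 *ℕ n))) (sym (next 2))) (sym (next 0)) ⟩
    F (2 +ℕ 2 *ℕ suc n) + F (2 *ℕ suc n) ∎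

  B-step : sign (suc n) * morganVoyce-B (suc n) -[1+ 4 ] ≡ F (2 +ℕ 2 *ℕ suc n)
  B-step = begin
    (-[1+ 0 ] * s) * morganVoyce-B (suc n) -[1+ 4 ]
      ≡⟨ cong ((-[1+ 0 ] * s) *_) (morganVoyce-B-rec n -[1+ 4 ]) ⟩
    (-[1+ 0 ] * s) * (morganVoyce-b (suc n) -[1+ 4 ] + Bₙ)
      ≡⟨ sign-distrib s (morganVoyce-b (suc n) -[1+ 4 ]) Bₙ ⟩
    sign (suc n) * morganVoyce-b (suc n) -[1+ 4 ] - s * Bₙ
      ≡⟨ cong₂ _-_ b-step ih-B ⟩
    (F (2 +ℕ 2 *ℕ suc n) + F (2 *ℕ suc n)) - F (2 +ℕ 2 *ℕ n)
      ≡⟨ cong (λ t → (F (2 +ℕ 2 *ℕ suc n) + t) - F (2 +ℕ 2 *ℕ n)) (next 0) ⟩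
    (F (2 +ℕ 2 *ℕ suc n) + F (2 +ℕ 2 *ℕ n)) - F (2 +ℕ 2 *ℕ n)
      ≡⟨ cancelʳ (F (2 +ℕ 2 *ℕ suc n)) (F (2 +ℕ 2 *ℕ n)) ⟩
    F (2 +ℕ 2 *ℕ suc n) ∎

-- The coefficients appearing in the theorem, and their Morgan–Voyce form:
-- one Pascal step turns the even-index coefficient into C(n+k+1, n-k), and two
-- Pascal steps turn the odd-index one into C(n+k+2, n-k-1) + C(n+k+1, n-k).

evenCoeff oddCoeff : ℕ → ℕ → ℤ
evenCoeff n k = binomℤ (n +ℕ k +ℕ 2) (n ⊖ k) - binomℤ (n +ℕ k +ℕ 1) (n ⊖ (k +ℕ 1))
oddCoeff  n k = binomℤ (n +ℕ k +ℕ 2) (n ⊖ k) - binomℤ (n +ℕ k) (n ⊖ (k +ℕ 2))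

evenCoeff≡BCoeff : ∀ n k → evenCoeff n k ≡ BCoeff n k
evenCoeff≡BCoeff n k = begin
  binomℤ (n +ℕ k +ℕ 2) (n ⊖ k) - binomℤ (n +ℕ k +ℕ 1) (n ⊖ (k +ℕ 1))
    ≡⟨ cong₂ (λ a i → binomℤ a (n ⊖ k) - binomℤ (n +ℕ k +ℕ 1) (n ⊖ i)) (ℕP.+-comm (n +ℕ k) 2) (ℕP.+-comm k 1) ⟩
  binomℤ (suc (suc (n +ℕ k))) (n ⊖ k) - binomℤ (n +ℕ k +ℕ 1) (n ⊖ suc k)
    ≡⟨ cong₂ _-_ (binomℤ-pascal (suc (n +ℕ k)) n k) (cong (λ a → binomℤ a (n ⊖ suc k)) (ℕP.+-comm (n +ℕ k) 1)) ⟩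
  (BCoeff n k + binomℤ (suc (n +ℕ k)) (n ⊖ suc k)) - binomℤ (suc (n +ℕ k)) (n ⊖ suc k)
    ≡⟨ cancelʳ (BCoeff n k) _ ⟩
  BCoeff n k ∎

oddCoeff-suc : ∀ m k → oddCoeff (suc m) k ≡ BCoeff (suc m) k + BCoeff m k
oddCoeff-suc m k = begin
  binomℤ (suc m +ℕ k +ℕ 2) (suc m ⊖ k) - binomℤ (suc m +ℕ k) (suc m ⊖ (k +ℕ 2))
    ≡⟨ cong₂ (λ a i → binomℤ a (suc m ⊖ k) - binomℤ (suc m +ℕ k) (suc m ⊖ i)) (ℕP.+-comm (suc m +ℕ k) 2) (ℕP.+-comm k 2) ⟩
  binomℤ (suc (suc (suc m +ℕ k))) (suc m ⊖ k) - binomℤ (suc (m +ℕ k)) (suc m ⊖ suc (suc k))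
    ≡⟨ cong₂ _-_ (binomℤ-pascal (suc (suc m +ℕ k)) (suc m) k)
                 (cong (binomℤ (suc (m +ℕ k))) (ℤP.[1+m]⊖[1+n]≡m⊖n m (suc k))) ⟩
  (BCoeff (suc m) k + binomℤ (suc (suc (m +ℕ k))) (suc m ⊖ suc k)) - binomℤ (suc (m +ℕ k)) (m ⊖ suc k)
    ≡⟨ cong (λ t → (BCoeff (suc m) k + t) - binomℤ (suc (m +ℕ k)) (m ⊖ suc k))
            (trans (cong (binomℤ (suc (suc (m +ℕ k)))) (ℤP.[1+m]⊖[1+n]≡m⊖n m k)) (binomℤ-pascal (suc (m +ℕ k)) m k)) ⟩
  (BCoeff (suc m) k + (BCoeff m k + r)) - r
    ≡⟨ regroup (BCoeff (suc m) k) (BCoeff m k) r ⟩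
  BCoeff (suc m) k + BCoeff m k ∎
  where
  r : ℤ
  r = binomℤ (suc (m +ℕ k)) (m ⊖ suc k)

  regroup : ∀ p q r → (p + (q + r)) - r ≡ p + q
  regroup = solve-∀

evenSum : ∀ n → sign n * sumTo n (λ k → evenCoeff n k * -[1+ 4 ] ^ℤ k) ≡ F (2 +ℕ 2 *ℕ n)
evenSum n = trans (cong (sign n *_) (sumTo-cong n (λ k → cong (_* -[1+ 4 ] ^ℤ k) (evenCoeff≡BCoeff n k))))
                  (proj₁ (morganVoyce-at-minus5 n))

oddSum : ∀ n → sign n * sumTo n (λ k → oddCoeff n k * -[1+ 4 ] ^ℤ k) ≡ F (2 +ℕ 2 *ℕ n) - F (2 *ℕ n)
oddSum zero    = refl
oddSum (suc m) = begin
  sign (suc m) * sumTo (suc m) (λ k → oddCoeff (suc m) k * x ^ℤ k)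
    ≡⟨ cong (sign (suc m) *_) sum-split ⟩
  (-[1+ 0 ] * sign m) * (morganVoyce-B (suc m) x + morganVoyce-B m x)
    ≡⟨ sign-distrib (sign m) (morganVoyce-B (suc m) x) (morganVoyce-B m x) ⟩
  sign (suc m) * morganVoyce-B (suc m) x - sign m * morganVoyce-B m x
    ≡⟨ cong₂ _-_ (proj₁ (morganVoyce-at-minus5 (suc m))) (proj₁ (morganVoyce-at-minus5 m)) ⟩
  F (2 +ℕ 2 *ℕ suc m) - F (2 +ℕ 2 *ℕ m)
    ≡⟨ cong (λ j → F (2 +ℕ 2 *ℕ suc m) - F j) (ℕP.*-suc 2 m) ⟨
  F (2 +ℕ 2 *ℕ suc m) - F (2 *ℕ suc m) ∎
  where
  x : ℤ
  x = -[1+ 4 ]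

  sum-split : sumTo (suc m) (λ k → oddCoeff (suc m) k * x ^ℤ k) ≡ morganVoyce-B (suc m) x + morganVoyce-B m x
  sum-split = begin
    sumTo (suc m) (λ k → oddCoeff (suc m) k * x ^ℤ k)
      ≡⟨ sumTo-cong (suc m) (λ k → trans (cong (_* x ^ℤ k) (oddCoeff-suc m k))
                                         (ℤP.*-distribʳ-+ (x ^ℤ k) (BCoeff (suc m) k) (BCoeff m k))) ⟩
    sumTo (suc m) (λ k → BCoeff (suc m) k * x ^ℤ k + BCoeff m k * x ^ℤ k)
      ≡⟨ sumTo-+ (suc m) _ _ ⟩
    morganVoyce-B (suc m) x + sumTo (suc m) (λ k → BCoeff m k * x ^ℤ k)
      ≡⟨ cong (_+_ (morganVoyce-B (suc m) x)) (sumTo-drop-last m _ (cong (_* x ^ℤ suc m) (BCoeff-top m))) ⟩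
    morganVoyce-B (suc m) x + morganVoyce-B m x ∎

mainTheorem9 : (n : ℕ) →
    (+ fib (2 *ℕ n +ℕ 2) ≡ (-[1+ 0 ] ^ℤ n) * sumTo n (λ k →
        (binomℤ (n +ℕ k +ℕ 2) (n ⊖ k) - binomℤ (n +ℕ k +ℕ 1) (n ⊖ (k +ℕ 1))) * (-[1+ 4 ] ^ℤ k)))
    × (+ fib (2 *ℕ n +ℕ 1) ≡ (-[1+ 0 ] ^ℤ n) * sumTo n (λ k →
        (binomℤ (n +ℕ k +ℕ 2) (n ⊖ k) - binomℤ (n +ℕ k) (n ⊖ (k +ℕ 2))) * (-[1+ 4 ] ^ℤ k)))
mainTheorem9 n = even-index , odd-index
  where
  even-index : F (2 *ℕ n +ℕ 2) ≡ sign n * sumTo n (λ k → evenCoeff n k * -[1+ 4 ] ^ℤ k)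
  even-index = trans (cong F (ℕP.+-comm (2 *ℕ n) 2)) (sym (evenSum n))

  odd-index : F (2 *ℕ n +ℕ 1) ≡ sign n * sumTo n (λ k → oddCoeff n k * -[1+ 4 ] ^ℤ k)
  odd-index = begin
    F (2 *ℕ n +ℕ 1)               ≡⟨ cong F (ℕP.+-comm (2 *ℕ n) 1) ⟩
    F (1 +ℕ 2 *ℕ n)               ≡⟨ fib-odd (2 *ℕ n) ⟩
    F (2 +ℕ 2 *ℕ n) - F (2 *ℕ n)  ≡⟨ oddSum n ⟨
    sign n * sumTo n (λ k → oddCoeff n k * -[1+ 4 ] ^ℤ k) ∎
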